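{- Let $g,g'$ and $h,h'$ be bounding functions and let $(\sigma,\mu)$ be a pair of strings. Suppose that $B,C$ are sets of pairs of strings and that $B\cup C$ is $(g+g',h+h')$-big above $(\sigma,\mu)$. Then either $B$ is $(g,h)$-big above $(\sigma,\mu)$ or $C$ is $(g',h')$-big above $(\sigma,\mu)$.
   Context: A bounding function is a computable function $\omega\to[2,\omega)$. Strings are elements of $\omega^{<\omega}$; $\sigma^{\preceq}$ is the set of strings extending $\sigma$. A tree above $\sigma$ is a nonempty subset of $\sigma^{\preceq}$ closed under initial segments of length $\ge|\sigma|$; a leaf is an element with no proper extension in the tree; a tree is $h$-bushy if every non-leaf $\tau$ has at least $h(|\tau|)$ immediate successors (extensions of length $|\tau|+1$) in it. A finite tree $F'$ is an end-extension of $F$ if $F\subseteq F'$ and every string in $F'\setminus F$ extends a leaf of $F$. For a set $A$ of pairs of strings, $A(\tau)=\{\rho:(\tau,\rho)\in A\}$, $\operatorname{dom}A=\{\tau:A(\tau)\ne\emptyset\}$. A finite tree system above $(\sigma,\mu)$ is a finite set $T$ of pairs of strings such that $\operatorname{dom}T$ is a tree above $\sigma$, each $T(\tau)$ ($\tau\in\operatorname{dom}T$) is a finite tree above $\mu$, and if $\tau\prec\tau'$ in $\operatorname{dom}T$ then $T(\tau')$ is an end-extension of $T(\tau)$. A leaf of $T$ is a pair $(\tau,\rho)\in T$ with $\tau$ a leaf of $\operatorname{dom}T$ and $\rho$ a leaf of $T(\tau)$. $T$ is $(g,h)$-bushy if $\operatorname{dom}T$ is $g$-bushy and each $T(\tau)$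 is $h$-bushy. A set $B$ of pairs is $(g,h)$-big above $(\sigma,\mu)$ if there is a finite $(g,h)$-bushy tree system above $(\sigma,\mu)$ all of whose leaves lie in $B$. -}

module Defs where

open import Data.Nat using (ℕ; _≤_; _+_)
open import Data.List using (List; []; _∷_; _++_; [_]; length)
open import Data.List.Membership.Propositional using (_∈_)
open import Data.List.Relation.Unary.Unique.Propositional using (Unique)
open import Data.Product using (Σ; ∃; _×_; _,_)
open import Relation.Binary.PropositionalEquality using (_≡_; _≢_)
open import Relation.Nullary using (¬_)

Str : Set
Str = List ℕ

_≼_ : Str → Str → Set
σ ≼ τ = ∃ λ ρ → σ ++ ρ ≡ τ

_≺_ : Str → Str → Set
σ ≺ τ = (σ ≼ τ) × (σ ≢ τ)

-- A bounding function: ω → [2, ω) (every Agda function is computable).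
BoundingFunction : (ℕ → ℕ) → Set
BoundingFunction f = ∀ n → 2 ≤ f n

_⊕_ : (ℕ → ℕ) → (ℕ → ℕ) → (ℕ → ℕ)
(f ⊕ g) n = f n + g n

-- Sets of strings are given as predicates (finiteness is imposed separately).
StrSet : Set₁
StrSet = Str → Set

PairSet : Set₁
PairSet = Str × Str → Set

IsTreeAbove : Str → StrSet → Set
IsTreeAbove σ S =
  (∃ λ τ → S τ)
  × (∀ τ → S τ → σ ≼ τ)
  × (∀ τ ρ → S τ → σ ≼ ρ → ρ ≼ τ → S ρ)

IsLeaf : StrSet → Str → Set
IsLeaf S τ = S τ × (∀ ρ → S ρ → ¬ (τ ≺ ρ))

AtLeastSuccs : ℕ → StrSet → Str → Set
AtLeastSuccs k S τ =
  ∃ λ (L : List ℕ) → Unique L × (k ≤ length L) × (∀ n → n ∈ L → S (τ ++ [ n ]))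

Bushy : (ℕ → ℕ) → StrSet → Set
Bushy h S = ∀ τ → S τ → ¬ IsLeaf S τ → AtLeastSuccs (h (length τ)) S τ

EndExtension : StrSet → StrSet → Set
EndExtension F F' =
  (∀ τ → F τ → F' τ)
  × (∀ τ → F' τ → ¬ F τ → ∃ λ ρ → IsLeaf F ρ × (ρ ≼ τ))

FinPairSet : Set
FinPairSet = List (Str × Str)

section : FinPairSet → Str → StrSet
section A τ ρ = (τ , ρ) ∈ A

dom : FinPairSet → StrSet
dom A τ = ∃ λ ρ → (τ , ρ) ∈ A

-- T is a finite tree system above (σ , μ).  (Each T(τ) is finite since T is.)
IsTreeSystem : Str → Str → FinPairSet → Set
IsTreeSystem σ μ T =
  IsTreeAbove σ (dom T)
  × (∀ τ → dom T τ → IsTreeAbove μ (section T τ))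
  × (∀ τ τ' → dom T τ → dom T τ' → τ ≺ τ' → EndExtension (section T τ) (section T τ'))

IsSysLeaf : FinPairSet → Str → Str → Set
IsSysLeaf T τ ρ = (τ , ρ) ∈ T × IsLeaf (dom T) τ × IsLeaf (section T τ) ρ

SysBushy : (ℕ → ℕ) → (ℕ → ℕ) → FinPairSet → Set
SysBushy g h T = Bushy g (dom T) × (∀ τ → dom T τ → Bushy h (section T τ))

Big : (ℕ → ℕ) → (ℕ → ℕ) → PairSet → Str → Str → Set
Big g h B σ μ =
  ∃ λ (T : FinPairSet) →
    IsTreeSystem σ μ T × SysBushy g h T × (∀ τ ρ → IsSysLeaf T τ ρ → B (τ , ρ))

module Submission where

-- A finite h-bushy tree with leaves in P is, for our purposes,
-- the same thing as an inductive witness (BushyTree h P τ): either a leaf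
-- satisfying P, or a node with at least h(|τ|) distinct immediate successors,
-- each carrying a witness again.  On witnesses the theorem is a pigeonhole
-- argument by induction: if a node has h(|τ|) + h'(|τ|) children, each
-- yielding an h-witness for P or an h'-witness for Q, then h(|τ|) of them
-- yield the former or h'(|τ|) of them the latter (split).

open import Defs
open import Data.Nat using (ℕ; zero; suc; _+_; _≤_; _<_; z≤n; s≤s; _≟_)
open import Data.Nat.Properties
  using (≤-refl; ≤-trans; ≤-reflexive; ≤-antisym; ≤-pred; <⇒≤; <⇒≱; ≰⇒>; _≤?_;
         m≤m+n; m≤n+m; m<m+n; 1+n≢n; +-comm; +-suc; +-monoˡ-≤; +-cancelˡ-≤)
open import Data.List using (List; []; _∷_; _++_; [_]; length; map; concat)
open import Data.List.Properties using (++-identityʳ; ++-assoc; length-++; ∷-injective; ∷-injectiveˡ; ∷-injectiveʳ; ++-cancelˡ)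
import Data.List.Properties as ListProps
open import Data.List.Membership.Propositional using (_∈_; mapWith∈; lose)
open import Data.List.Membership.Propositional.Properties using (∈-map⁺; ∈-map⁻; ∈-concat⁺; ∈-concat⁻)
open import Data.List.Membership.Propositional.Properties.WithK using (unique⇒irrelevant)
import Data.List.Membership.DecPropositional as DecMembership
open import Data.List.Relation.Binary.Subset.Propositional using (_⊆_)
open import Data.List.Relation.Unary.Any using (here; there; any?; satisfied)
open import Data.List.Relation.Unary.Any.Properties using (mapWith∈⁺; mapWith∈⁻)
import Data.List.Relation.Unary.All as All
open import Data.List.Relation.Unary.AllPairs using (_∷_; [])
open import Data.List.Relation.Unary.Unique.Propositional using (Unique)
import Data.Product.Properties as ProductProps
open import Data.Product using (Σ; ∃; ∃₂; _×_; _,_; proj₁; proj₂)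
open import Data.Sum as Sum using (_⊎_; inj₁; inj₂)
open import Data.Empty using (⊥-elim)
open import Function using (_∘_)
open import Relation.Nullary using (¬_; Dec; yes; no)
open import Relation.Nullary.Decidable using (_×-dec_; ¬?; map′)
open import Relation.Binary.PropositionalEquality using (_≡_; refl; sym; trans; cong; subst)

-- 1. The prefix order on strings

≼-refl : ∀ u → u ≼ u
≼-refl u = [] , ++-identityʳ u

≼-trans : ∀ {u v w} → u ≼ v → v ≼ w → u ≼ w
≼-trans {u} (r , refl) (s , refl) = r ++ s , sym (++-assoc u r s)

≼-length : ∀ {u x} → u ≼ x → length u ≤ length x
≼-length {u} (r , refl) = subst (length u ≤_) (sym (length-++ u)) (m≤m+n _ _)

length-child : ∀ (τ : Str) n → length (τ ++ [ n ]) ≡ suc (length τ)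
length-child τ n = trans (length-++ τ) (+-comm (length τ) 1)

≼-by-length : ∀ u {x} y → u ≼ x → y ≼ x → length u ≤ length y → u ≼ y
≼-by-length [] y _ _ _ = y , refl
≼-by-length (a ∷ u) [] _ _ ()
≼-by-length (a ∷ u) (b ∷ y) (r , refl) (r' , eq) (s≤s le) with ∷-injective eq
... | refl , eq' with ≼-by-length u y (r , refl) (r' , eq') le
... | s , e = s , cong (a ∷_) e

≼-antisym : ∀ {u x} → u ≼ x → x ≼ u → u ≡ x
≼-antisym {u} ([] , refl) _ = sym (++-identityʳ u)
≼-antisym {u} ((c ∷ r) , refl) q =
  ⊥-elim (<⇒≱ (subst (length u <_) (sym (length-++ u)) (m<m+n (length u) (s≤s z≤n))) (≼-length q))

≼-unique : ∀ {u y x} → u ≼ x → y ≼ x → length u ≡ length y → u ≡ y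
≼-unique {u} {y} p q e =
  ≼-antisym (≼-by-length u y p q (≤-reflexive e)) (≼-by-length y u q p (≤-reflexive (sym e)))

child-injective : ∀ {τ m n x} → (τ ++ [ m ]) ≼ x → (τ ++ [ n ]) ≼ x → m ≡ n
child-injective {τ} {m} {n} p q =
  ∷-injectiveˡ (++-cancelˡ τ [ m ] [ n ] (≼-unique p q (trans (length-child τ m) (sym (length-child τ n)))))

≺-length : ∀ {u x} → u ≺ x → length u < length x
≺-length {u} (([] , refl) , u≢u) = ⊥-elim (u≢u (sym (++-identityʳ u)))
≺-length {u} (((c ∷ r) , refl) , _) = subst (length u <_) (sym (length-++ u)) (m<m+n (length u) (s≤s z≤n))

≺-child : ∀ τ n → τ ≺ (τ ++ [ n ])
≺-child τ n = ([ n ] , refl) , λ e → 1+n≢n (sym (trans (cong length e) (length-child τ n)))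

child-≼-length : ∀ {τ n x} → (τ ++ [ n ]) ≼ x → length τ < length x
child-≼-length {τ} {n} p = subst (_≤ _) (length-child τ n) (≼-length p)

parent-or-through-child : ∀ {τ y x n} → τ ≼ y → y ≼ x → (τ ++ [ n ]) ≼ x → y ≡ τ ⊎ (τ ++ [ n ]) ≼ y
parent-or-through-child {τ} {y} {x} {n} p q r with suc (length τ) ≤? length y
... | yes le = inj₂ (≼-by-length (τ ++ [ n ]) y r q (subst (_≤ length y) (sym (length-child τ n)) le))
... | no nle = inj₁ (≼-unique q (≼-trans (proj₁ (≺-child τ n)) r) (≤-antisym (≤-pred (≰⇒> nle)) (≼-length p)))

child-index-unique : ∀ {L : List ℕ} → Unique L → ∀ {τ x m n} (p : m ∈ L) (q : n ∈ L)
                   → (τ ++ [ m ]) ≼ x → (τ ++ [ n ]) ≼ x → _≡_ {A = Σ ℕ (_∈ L)} (m , p) (n , q)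
child-index-unique u p q a b with child-injective a b
... | refl with unique⇒irrelevant u p q
... | refl = refl

_≼?_ : ∀ u x → Dec (u ≼ x)
[] ≼? x = yes (x , refl)
(a ∷ u) ≼? [] = no λ { (r , ()) }
(a ∷ u) ≼? (b ∷ x) with a ≟ b
... | no a≢b = no λ { (r , eq) → a≢b (∷-injectiveˡ eq) }
... | yes refl with u ≼? x
... | yes (r , e) = yes (r , cong (a ∷_) e)
... | no u⋠x = no λ { (r , eq) → u⋠x (r , ∷-injectiveʳ eq) }

_≺?_ : ∀ u x → Dec (u ≺ x)
u ≺? x = (u ≼? x) ×-dec ¬? (ListProps.≡-dec _≟_ u x)

-- 2. Families of at least k distinct numbers

-- At least k distinct numbers satisfying A; AtLeastSuccs k S τ is
-- definitionally Many k (λ n → S (τ ++ [ n ])).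
Many : ℕ → (ℕ → Set) → Set
Many k A = ∃ λ (L : List ℕ) → Unique L × (k ≤ length L) × (∀ n → n ∈ L → A n)

Many-map : ∀ {k A A'} → (∀ n → A n → A' n) → Many k A → Many k A'
Many-map F (L , u , enough , all) = L , u , enough , λ n p → F n (all n p)

elements : ∀ {k A} → Many k A → List ℕ
elements = proj₁

distinct : ∀ {k A} (m : Many k A) → Unique (elements m)
distinct = proj₁ ∘ proj₂

-- The A-witness attached to each element; in a witness tree, the subtree at a child.
subtree : ∀ {k A} (m : Many k A) → ∀ n → n ∈ elements m → A n
subtree (_ , _ , _ , f) = f

record Partition (A B : ℕ → Set) (L : List ℕ) : Set where
  field
    left right : List ℕ
    left-unique : Unique left
    right-unique : Unique right
    left⊆ : left ⊆ L
    right⊆ : right ⊆ L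
    sizes : length left + length right ≡ length L
    left-A : ∀ n → n ∈ left → A n
    right-B : ∀ n → n ∈ right → B n

unique-cons : ∀ {m : ℕ} {L L'} → Unique (m ∷ L) → L' ⊆ L → Unique L' → Unique (m ∷ L')
unique-cons (m∉L ∷ _) L'⊆L u' = All.tabulate (λ n∈ → All.lookup m∉L (L'⊆L n∈)) ∷ u'

cons⊆ : ∀ {m : ℕ} {L L'} → L' ⊆ L → (m ∷ L') ⊆ (m ∷ L)
cons⊆ L'⊆L (here e) = here e
cons⊆ L'⊆L (there n∈) = there (L'⊆L n∈)

cons-all : ∀ {A : ℕ → Set} {m L} → A m → (∀ n → n ∈ L → A n) → ∀ n → n ∈ m ∷ L → A n
cons-all a all n (here refl) = a
cons-all a all n (there n∈) = all n n∈

partition : ∀ {A B : ℕ → Set} (L : List ℕ) → Unique L → (∀ n → n ∈ L → A n ⊎ B n) → Partition A B L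
partition [] _ _ = record
  { left = [] ; right = [] ; left-unique = [] ; right-unique = [] ; left⊆ = λ () ; right⊆ = λ ()
  ; sizes = refl ; left-A = λ _ () ; right-B = λ _ () }
partition (m ∷ L) u@(_ ∷ uL) choice with partition L uL (λ n p → choice n (there p)) | choice m (here refl)
... | rest | inj₁ a = record
  { left = m ∷ left ; right = right
  ; left-unique = unique-cons u left⊆ left-unique ; right-unique = right-unique
  ; left⊆ = cons⊆ left⊆ ; right⊆ = λ n∈ → there (right⊆ n∈)
  ; sizes = cong suc sizes ; left-A = cons-all a left-A ; right-B = right-B }
  where open Partition rest
... | rest | inj₂ b = record
  { left = left ; right = m ∷ right
  ; left-unique = left-unique ; right-unique = unique-cons u right⊆ right-unique
  ; left⊆ = λ n∈ → there (left⊆ n∈) ; right⊆ = cons⊆ right⊆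
  ; sizes = trans (+-suc (length left) (length right)) (cong suc sizes)
  ; left-A = left-A ; right-B = cons-all b right-B }
  where open Partition rest

sum-≤-split : ∀ a b c d → c + d ≤ a + b → c ≤ a ⊎ d ≤ b
sum-≤-split a b c d le with c ≤? a
... | yes c≤a = inj₁ c≤a
... | no c≰a = inj₂ (<⇒≤ (+-cancelˡ-≤ a _ _
        (subst (_≤ a + b) (sym (+-suc a d)) (≤-trans (+-monoˡ-≤ d (≰⇒> c≰a)) le))))

pigeonhole : ∀ a b {A B : ℕ → Set} → Many (a + b) (λ n → A n ⊎ B n) → Many a A ⊎ Many b B
pigeonhole a b (L , u , enough , choice) =
  Sum.map (λ a≤ → left , left-unique , a≤ , left-A) (λ b≤ → right , right-unique , b≤ , right-B)
    (sum-≤-split (length left) (length right) a b (subst (a + b ≤_) (sym sizes) enough))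
  where open Partition (partition L u choice)

-- 3. Sets of strings: extensional equality and the one-node tree

-- The tree notions of Defs are stated for predicates; the sets we build
-- are only extensionally equal to the ones we reason about.
_≐_ : StrSet → StrSet → Set
S ≐ S' = (∀ x → S x → S' x) × (∀ x → S' x → S x)

≐-sym : ∀ {S S'} → S ≐ S' → S' ≐ S
≐-sym (to , from) = from , to

≐-trans : ∀ {S S' S''} → S ≐ S' → S' ≐ S'' → S ≐ S''
≐-trans (to , from) (to' , from') = (λ x s → to' x (to x s)) , (λ x s → from x (from' x s))

≐-leaf : ∀ {S S'} → S ≐ S' → ∀ {x} → IsLeaf S x → IsLeaf S' x
≐-leaf (to , from) (sx , maximal) = to _ sx , λ ρ s'ρ lt → maximal ρ (from ρ s'ρ) lt

≐-tree : ∀ {S S'} → S ≐ S' → ∀ {σ} → IsTreeAbove σ S → IsTreeAbove σ S'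
≐-tree (to , from) ((x , sx) , above , closed) =
  (x , to x sx) , (λ τ s → above τ (from τ s)) , λ τ ρ s p q → to ρ (closed τ ρ (from τ s) p q)

≐-bushy : ∀ {S S'} h → S ≐ S' → Bushy h S → Bushy h S'
≐-bushy h e@(to , from) bushy x s notLeaf =
  Many-map (λ n → to _) (bushy x (from x s) (λ lf → notLeaf (≐-leaf e lf)))

≐-endExtension : ∀ {F₁ F₁' F₂ F₂'} → F₁ ≐ F₁' → F₂ ≐ F₂' → EndExtension F₁' F₂' → EndExtension F₁ F₂
≐-endExtension (to₁ , from₁) (to₂ , from₂) (grows , new) =
  (λ τ s → from₂ τ (grows τ (to₁ τ s))) ,
  λ τ s notOld → let (ρ , lf , le) = new τ (to₂ τ s) (λ s' → notOld (from₁ τ s')) in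
                 ρ , ≐-leaf (from₁ , to₁) lf , le

tree-root : ∀ {μ S} → IsTreeAbove μ S → S μ
tree-root {μ} ((x , sx) , above , closed) = closed x μ sx (≼-refl μ) (above x sx)

Singleton : Str → StrSet
Singleton μ ρ = ρ ≡ μ

singleton-tree : ∀ μ → IsTreeAbove μ (Singleton μ)
singleton-tree μ = (μ , refl) , (λ { x refl → ≼-refl μ }) , λ { x y refl p q → ≼-antisym q p }

singleton-bushy : ∀ μ h → Bushy h (Singleton μ)
singleton-bushy μ h x refl notLeaf = ⊥-elim (notLeaf (refl , λ { ρ refl lt → proj₂ lt refl }))

singleton-endExtension : ∀ {μ S} → IsTreeAbove μ S → EndExtension (Singleton μ) S
singleton-endExtension {μ} tree@(_ , above , _) =
  (λ { τ refl → tree-root tree }) , λ τ s _ → μ , (refl , λ { ρ refl lt → proj₂ lt refl }) , above τ s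

-- 4. Bushy tree witnesses

data BushyTree (h : ℕ → ℕ) (P : StrSet) : Str → Set where
  leaf : ∀ {τ} → P τ → BushyTree h P τ
  node : ∀ {τ} → Many (h (length τ)) (λ n → BushyTree h P (τ ++ [ n ])) → BushyTree h P τ

mapBushyTree : ∀ {h} {P P' : StrSet} → (∀ x → P x → P' x) → ∀ {τ} → BushyTree h P τ → BushyTree h P' τ
mapBushyTree F (leaf p) = leaf (F _ p)
mapBushyTree F (node (L , u , enough , f)) = node (L , u , enough , λ n p → mapBushyTree F (f n p))

⋃ : {A : Set} (L : List ℕ) → (∀ n → n ∈ L → List A) → List A
⋃ L F = concat (mapWith∈ L (λ {n} → F n))

∈-⋃⁺ : ∀ {A : Set} {L} (F : ∀ n → n ∈ L → List A) {n} (p : n ∈ L) {a} → a ∈ F n p → a ∈ ⋃ L F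
∈-⋃⁺ F p a∈ = ∈-concat⁺ (mapWith∈⁺ (λ {n} → F n) (_ , p , a∈))

∈-⋃⁻ : ∀ {A : Set} L (F : ∀ n → n ∈ L → List A) {a} → a ∈ ⋃ L F → ∃₂ λ n (p : n ∈ L) → a ∈ F n p
∈-⋃⁻ L F a∈ = mapWith∈⁻ L (λ {n} → F n) (∈-concat⁻ _ a∈)

module _ {h : ℕ → ℕ} {P : StrSet} where

  nodes : ∀ {τ} → BushyTree h P τ → List Str
  nodes {τ} (leaf _) = [ τ ]
  nodes {τ} (node (L , _ , _ , f)) = τ ∷ ⋃ L (λ n p → nodes (f n p))

  NodeSet : ∀ {τ} → BushyTree h P τ → StrSet
  NodeSet t x = x ∈ nodes t

  root∈nodes : ∀ {τ} (t : BushyTree h P τ) → τ ∈ nodes t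
  root∈nodes (leaf _) = here refl
  root∈nodes (node _) = here refl

  nodes-above : ∀ {τ} (t : BushyTree h P τ) {x} → x ∈ nodes t → τ ≼ x
  nodes-above {τ} (leaf _) (here refl) = ≼-refl τ
  nodes-above {τ} (node _) (here refl) = ≼-refl τ
  nodes-above {τ} (node (L , _ , _ , f)) (there x∈) with ∈-⋃⁻ L (λ n p → nodes (f n p)) x∈
  ... | n , p , x∈child = ≼-trans (proj₁ (≺-child τ n)) (nodes-above (f n p) x∈child)

  module _ {τ} (m : Many (h (length τ)) (λ n → BushyTree h P (τ ++ [ n ]))) where

    private
      f : ∀ n → n ∈ elements m → BushyTree h P (τ ++ [ n ])
      f = subtree m

    child⊆nodes : ∀ {n} (p : n ∈ elements m) {x} → x ∈ nodes (f n p) → x ∈ nodes (node m)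
    child⊆nodes p x∈ = there (∈-⋃⁺ (λ n p → nodes (f n p)) p x∈)

    child-upward-closed : ∀ {n} (p : n ∈ elements m) {x ρ}
                        → x ∈ nodes (f n p) → ρ ∈ nodes (node m) → x ≼ ρ → ρ ∈ nodes (f n p)
    child-upward-closed {n} p x∈ (here refl) x≼τ =
      ⊥-elim (<⇒≱ (child-≼-length (nodes-above (f n p) x∈)) (≼-length x≼τ))
    child-upward-closed {n} p x∈ (there ρ∈) x≼ρ with ∈-⋃⁻ (elements m) (λ n p → nodes (f n p)) ρ∈
    ... | k , q , ρ∈child
        with child-index-unique (distinct m) q p (nodes-above (f k q) ρ∈child) (≼-trans (nodes-above (f n p) x∈) x≼ρ)
    ... | refl = ρ∈child

    child-leaf⇒leaf : ∀ {n} (p : n ∈ elements m) {x}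
                    → x ∈ nodes (f n p) → IsLeaf (NodeSet (f n p)) x → IsLeaf (NodeSet (node m)) x
    child-leaf⇒leaf p x∈ (_ , maximal) =
      child⊆nodes p x∈ , λ ρ ρ∈ lt → maximal ρ (child-upward-closed p x∈ ρ∈ (proj₁ lt)) lt

    leaf⇒child-leaf : ∀ {n} (p : n ∈ elements m) {x}
                    → x ∈ nodes (f n p) → IsLeaf (NodeSet (node m)) x → IsLeaf (NodeSet (f n p)) x
    leaf⇒child-leaf p x∈ (_ , maximal) = x∈ , λ ρ ρ∈ lt → maximal ρ (child⊆nodes p ρ∈) lt

  nodes-closed : ∀ {τ} (t : BushyTree h P τ) {x y} → x ∈ nodes t → τ ≼ y → y ≼ x → y ∈ nodes t
  nodes-closed (leaf _) (here refl) p q = here (sym (≼-antisym p q))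
  nodes-closed (node _) (here refl) p q = here (sym (≼-antisym p q))
  nodes-closed (node m@(L , _ , _ , f)) (there x∈) p q with ∈-⋃⁻ L (λ n p → nodes (f n p)) x∈
  ... | n , p' , x∈child with parent-or-through-child p q (nodes-above (f n p') x∈child)
  ... | inj₁ refl = here refl
  ... | inj₂ r = child⊆nodes m p' (nodes-closed (f n p') x∈child r q)

  nodes-tree : ∀ {τ} (t : BushyTree h P τ) → IsTreeAbove τ (NodeSet t)
  nodes-tree t = (_ , root∈nodes t) , (λ x → nodes-above t) , λ x y x∈ p q → nodes-closed t x∈ p q

  leaf-is-leaf : ∀ {τ} (p : P τ) → IsLeaf (NodeSet (leaf {h} p)) τ
  leaf-is-leaf p = here refl , λ { ρ (here refl) lt → proj₂ lt refl }

  module _ (h-pos : ∀ n → 1 ≤ h n) where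

    node-root-not-leaf : ∀ {τ} (m : Many (h (length τ)) (λ n → BushyTree h P (τ ++ [ n ]))) → ¬ IsLeaf (NodeSet (node m)) τ
    node-root-not-leaf {τ} ([] , _ , enough , _) _ = <⇒≱ (h-pos (length τ)) enough
    node-root-not-leaf {τ} m@((n ∷ L) , u , enough , f) (_ , maximal) =
      maximal (τ ++ [ n ]) (child⊆nodes m (here refl) (root∈nodes (f n (here refl)))) (≺-child τ n)

    leaf-or-branching : ∀ {τ} (t : BushyTree h P τ) {x} → x ∈ nodes t
      → (P x × IsLeaf (NodeSet t) x) ⊎ (AtLeastSuccs (h (length x)) (NodeSet t) x × ¬ IsLeaf (NodeSet t) x)
    leaf-or-branching (leaf p) (here refl) = inj₁ (p , leaf-is-leaf p)
    leaf-or-branching (node m@(L , u , enough , f)) (here refl) =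
      inj₂ ((L , u , enough , λ n p → child⊆nodes m p (root∈nodes (f n p))) , node-root-not-leaf m)
    leaf-or-branching (node m@(L , u , enough , f)) (there x∈) with ∈-⋃⁻ L (λ n p → nodes (f n p)) x∈
    ... | n , p , x∈child with leaf-or-branching (f n p) x∈child
    ... | inj₁ (px , lf) = inj₁ (px , child-leaf⇒leaf m p x∈child lf)
    ... | inj₂ (succs , notLeaf) =
      inj₂ (Many-map (λ _ → child⊆nodes m p) succs , λ lf → notLeaf (leaf⇒child-leaf m p x∈child lf))

    nodes-bushy : ∀ {τ} (t : BushyTree h P τ) → Bushy h (NodeSet t)
    nodes-bushy t x x∈ notLeaf with leaf-or-branching t x∈
    ... | inj₁ (_ , lf) = ⊥-elim (notLeaf lf)
    ... | inj₂ (succs , _) = succs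

    nodes-leaves : ∀ {τ} (t : BushyTree h P τ) x → IsLeaf (NodeSet t) x → P x
    nodes-leaves t x lf with leaf-or-branching t (proj₁ lf)
    ... | inj₁ (px , _) = px
    ... | inj₂ (_ , notLeaf) = ⊥-elim (notLeaf lf)

-- 5. Witnesses from finite bushy trees

totalLength : List Str → ℕ
totalLength [] = 0
totalLength (x ∷ X) = length x + totalLength X

length≤totalLength : ∀ {X x} → x ∈ X → length x ≤ totalLength X
length≤totalLength {y ∷ X} (here refl) = m≤m+n _ _
length≤totalLength {y ∷ X} (there x∈) = ≤-trans (length≤totalLength x∈) (m≤n+m _ _)

-- Successive nodes grow in
-- length and all lie in X, which bounds the recursion depth.
module _ (h : ℕ → ℕ) (S : StrSet) (S? : ∀ x → Dec (S x)) (X : List Str)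
         (S⊆X : ∀ x → S x → x ∈ X) (bushy : Bushy h S) where

  leaf? : ∀ x → S x → Dec (IsLeaf S x)
  leaf? x sx with any? (λ ρ → S? ρ ×-dec (x ≺? ρ)) X
  ... | yes ext = no λ lf → proj₂ lf _ (proj₁ (proj₂ (satisfied ext))) (proj₂ (proj₂ (satisfied ext)))
  ... | no noExt = yes (sx , λ ρ sρ lt → noExt (lose (S⊆X ρ sρ) (sρ , lt)))

  witness-within : (fuel : ℕ) → ∀ x → S x → totalLength X ≤ length x + fuel → BushyTree h (IsLeaf S) x
  witness-within fuel x sx bound with leaf? x sx
  ... | yes lf = leaf lf
  witness-within zero x sx bound | no notLeaf =
    ⊥-elim (notLeaf (sx , λ ρ sρ lt → <⇒≱ (≺-length lt)
      (≤-trans (length≤totalLength (S⊆X ρ sρ)) (subst (totalLength X ≤_) (+-comm (length x) 0) bound))))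
  witness-within (suc fuel) x sx bound | no notLeaf =
    node (Many-map (λ n sxn → witness-within fuel (x ++ [ n ]) sxn (longer n)) (bushy x sx notLeaf))
    where
      longer : ∀ n → totalLength X ≤ length (x ++ [ n ]) + fuel
      longer n = subst (totalLength X ≤_) (trans (+-suc (length x) fuel) (cong (_+ fuel) (sym (length-child x n)))) bound

  finite-tree⇒witness : ∀ x → S x → BushyTree h (IsLeaf S) x
  finite-tree⇒witness x sx = witness-within (totalLength X) x sx (m≤n+m _ _)

-- 6. Pigeonhole for witnesses

split : ∀ {h h'} {P Q : StrSet} {τ} → BushyTree (h ⊕ h') (λ x → P x ⊎ Q x) τ → BushyTree h P τ ⊎ BushyTree h' Q τ
split (leaf (inj₁ p)) = inj₁ (leaf p)
split (leaf (inj₂ q)) = inj₂ (leaf q)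
split {h} {h'} {τ = τ} (node (L , u , enough , f)) =
  Sum.map node node (pigeonhole (h (length τ)) (h' (length τ)) (L , u , enough , λ n p → split (f n p)))

-- 7. Bigness and nested witnesses

Nested : (g h : ℕ → ℕ) (B : PairSet) (σ μ : Str) → Set
Nested g h B σ μ = BushyTree g (λ τ → BushyTree h (λ ρ → B (τ , ρ)) μ) σ

section? : (T : FinPairSet) (τ : Str) → ∀ ρ → Dec (section T τ ρ)
section? T τ ρ = (τ , ρ) ∈? T
  where open DecMembership (ProductProps.≡-dec (ListProps.≡-dec _≟_) (ListProps.≡-dec _≟_)) using (_∈?_)

dom⊆ : (T : FinPairSet) → ∀ τ → dom T τ → τ ∈ map proj₁ T
dom⊆ T τ (ρ , r) = ∈-map⁺ proj₁ r

dom? : (T : FinPairSet) → ∀ τ → Dec (dom T τ)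
dom? T τ = map′ from (dom⊆ T τ) (τ ∈? map proj₁ T)
  where
    open DecMembership (ListProps.≡-dec _≟_) using (_∈?_)
    from : τ ∈ map proj₁ T → dom T τ
    from τ∈ with ∈-map⁻ proj₁ τ∈
    ... | (.τ , ρ) , r , refl = ρ , r

big⇒nested : ∀ {g h B σ μ} → Big g h B σ μ → Nested g h B σ μ
big⇒nested {g} {h} {B} {σ} {μ} (T , (dom-tree , section-tree , _) , (dom-bushy , section-bushy) , leaves) =
  mapBushyTree inner (finite-tree⇒witness g (dom T) (dom? T) (map proj₁ T) (dom⊆ T) dom-bushy σ (tree-root dom-tree))
  where
    inner : ∀ τ → IsLeaf (dom T) τ → BushyTree h (λ ρ → B (τ , ρ)) μ
    inner τ lf =
      mapBushyTree (λ ρ lfs → leaves τ ρ (proj₁ lfs , lf , lfs))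
        (finite-tree⇒witness h (section T τ) (section? T τ) (map proj₂ T) (λ ρ r → ∈-map⁺ proj₂ r)
           (section-bushy τ (proj₁ lf)) μ (tree-root (section-tree τ (proj₁ lf))))

module _ {g h : ℕ → ℕ} {B : PairSet} {μ : Str} where

  Inner : Str → Set
  Inner τ = BushyTree h (λ ρ → B (τ , ρ)) μ

  -- The tree system of a nested witness: an interior node τ carries the
  -- one-node tree {μ}, a leaf τ carries the nodes of its inner witness.
  pairs : ∀ {τ} → BushyTree g Inner τ → FinPairSet
  pairs {τ} (leaf q) = map (τ ,_) (nodes q)
  pairs {τ} (node (L , _ , _ , f)) = (τ , μ) ∷ ⋃ L (λ n p → pairs (f n p))

  pairs⇒node : ∀ {τ} (t : BushyTree g Inner τ) {x ρ} → (x , ρ) ∈ pairs t → x ∈ nodes t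
  pairs⇒node {τ} (leaf q) r with ∈-map⁻ (τ ,_) r
  ... | _ , _ , refl = here refl
  pairs⇒node (node _) (here refl) = here refl
  pairs⇒node (node m@(L , _ , _ , f)) (there r) with ∈-⋃⁻ L (λ n p → pairs (f n p)) r
  ... | n , p , r' = child⊆nodes m p (pairs⇒node (f n p) r')

  node⇒pairs : ∀ {τ} (t : BushyTree g Inner τ) {x} → x ∈ nodes t → (x , μ) ∈ pairs t
  node⇒pairs {τ} (leaf q) (here refl) = ∈-map⁺ (τ ,_) (root∈nodes q)
  node⇒pairs (node _) (here refl) = here refl
  node⇒pairs (node (L , _ , _ , f)) (there x∈) with ∈-⋃⁻ L (λ n p → nodes (f n p)) x∈
  ... | n , p , x∈child = there (∈-⋃⁺ (λ n p → pairs (f n p)) p (node⇒pairs (f n p) x∈child))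

  dom-pairs : ∀ {τ} (t : BushyTree g Inner τ) → dom (pairs t) ≐ NodeSet t
  dom-pairs t = (λ x (ρ , r) → pairs⇒node t r) , λ x x∈ → μ , node⇒pairs t x∈

  leaf-section : ∀ {τ} (q : Inner τ) → section (pairs (leaf q)) τ ≐ NodeSet q
  leaf-section {τ} q = (λ ρ r → from-map (∈-map⁻ (τ ,_) r)) , λ ρ ρ∈ → ∈-map⁺ (τ ,_) ρ∈
    where
      from-map : ∀ {ρ} → (∃ λ y → y ∈ nodes q × (τ , ρ) ≡ (τ , y)) → ρ ∈ nodes q
      from-map (y , y∈ , refl) = y∈

  root-section : ∀ {τ} (m : Many (g (length τ)) (λ n → BushyTree g Inner (τ ++ [ n ])))
               → section (pairs (node m)) τ ≐ Singleton μ
  root-section {τ} m@(L , _ , _ , f) = to , λ { ρ refl → here refl }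
    where
      to : ∀ ρ → (τ , ρ) ∈ pairs (node m) → ρ ≡ μ
      to ρ (here refl) = refl
      to ρ (there r) with ∈-⋃⁻ L (λ n p → pairs (f n p)) r
      ... | n , p , r' = ⊥-elim (<⇒≱ (child-≼-length (nodes-above (f n p) (pairs⇒node (f n p) r'))) ≤-refl)

  child-section : ∀ {τ} (m : Many (g (length τ)) (λ n → BushyTree g Inner (τ ++ [ n ]))) {n} (p : n ∈ elements m) {x}
                → x ∈ nodes (subtree m n p) → section (pairs (subtree m n p)) x ≐ section (pairs (node m)) x
  child-section m@(L , u , _ , f) {n} p {x} x∈ = (λ ρ r → there (∈-⋃⁺ (λ n p → pairs (f n p)) p r)) , from
    where
      from : ∀ ρ → (x , ρ) ∈ pairs (node m) → (x , ρ) ∈ pairs (f n p)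
      from ρ (here refl) = ⊥-elim (<⇒≱ (child-≼-length (nodes-above (f n p) x∈)) ≤-refl)
      from ρ (there r) with ∈-⋃⁻ L (λ n p → pairs (f n p)) r
      ... | k , q , r' with child-index-unique u q p (nodes-above (f k q) (pairs⇒node (f k q) r')) (nodes-above (f n p) x∈)
      ... | refl = r'

  data SectionShape {τ} (t : BushyTree g Inner τ) (x : Str) : Set where
    at-leaf : (q : Inner x) → IsLeaf (NodeSet t) x → section (pairs t) x ≐ NodeSet q → SectionShape t x
    at-interior : ¬ IsLeaf (NodeSet t) x → section (pairs t) x ≐ Singleton μ → SectionShape t x

  module _ (g-pos : ∀ n → 1 ≤ g n) where

    section-shape : ∀ {τ} (t : BushyTree g Inner τ) {x} → x ∈ nodes t → SectionShape t x
    section-shape (leaf q) (here refl) = at-leaf q (leaf-is-leaf {h = g} {P = Inner} q) (leaf-section q)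
    section-shape (node m) (here refl) = at-interior (node-root-not-leaf g-pos m) (root-section m)
    section-shape (node m@(L , u , enough , f)) (there x∈) with ∈-⋃⁻ L (λ n p → nodes (f n p)) x∈
    ... | n , p , x∈child with section-shape (f n p) x∈child
    ... | at-leaf q lf sec =
      at-leaf q (child-leaf⇒leaf m p x∈child lf) (≐-trans (≐-sym (child-section m p x∈child)) sec)
    ... | at-interior notLeaf sec =
      at-interior (λ lf → notLeaf (leaf⇒child-leaf m p x∈child lf)) (≐-trans (≐-sym (child-section m p x∈child)) sec)

  nested⇒big : (∀ n → 1 ≤ g n) → (∀ n → 1 ≤ h n) → ∀ {σ} → Nested g h B σ μ → Big g h B σ μ
  nested⇒big g-pos h-pos {σ} D =
    pairs D , (system-dom , system-sections , system-ends) , (≐-bushy g (≐-sym dom≐) (nodes-bushy g-pos D) , sections-bushy) , leaves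
    where
      T : FinPairSet
      T = pairs D

      dom≐ : dom T ≐ NodeSet D
      dom≐ = dom-pairs D

      shape : ∀ {x ρ} → (x , ρ) ∈ T → SectionShape D x
      shape r = section-shape g-pos D (pairs⇒node D r)

      system-dom : IsTreeAbove σ (dom T)
      system-dom = ≐-tree (≐-sym dom≐) (nodes-tree D)

      system-sections : ∀ τ → dom T τ → IsTreeAbove μ (section T τ)
      system-sections τ (_ , r) with shape r
      ... | at-leaf q _ sec = ≐-tree (≐-sym sec) (nodes-tree q)
      ... | at-interior _ sec = ≐-tree (≐-sym sec) (singleton-tree μ)

      system-ends : ∀ τ τ' → dom T τ → dom T τ' → τ ≺ τ' → EndExtension (section T τ) (section T τ')
      system-ends τ τ' (_ , r) (_ , r') lt with shape r | shape r'
      ... | at-leaf _ lf _ | _ = ⊥-elim (proj₂ lf τ' (pairs⇒node D r') lt)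
      ... | at-interior _ sec | at-leaf q _ sec' = ≐-endExtension sec sec' (singleton-endExtension (nodes-tree q))
      ... | at-interior _ sec | at-interior _ sec' = ≐-endExtension sec sec' (singleton-endExtension (singleton-tree μ))

      sections-bushy : ∀ τ → dom T τ → Bushy h (section T τ)
      sections-bushy τ (_ , r) with shape r
      ... | at-leaf q _ sec = ≐-bushy h (≐-sym sec) (nodes-bushy h-pos q)
      ... | at-interior _ sec = ≐-bushy h (≐-sym sec) (singleton-bushy μ h)

      leaves : ∀ τ ρ → IsSysLeaf T τ ρ → B (τ , ρ)
      leaves τ ρ (r , dom-leaf , section-leaf) with shape r
      ... | at-leaf q _ sec = nodes-leaves h-pos q ρ (≐-leaf sec section-leaf)
      ... | at-interior notLeaf _ = ⊥-elim (notLeaf (≐-leaf dom≐ dom-leaf))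

-- 8. The theorem

-- Bounding functions are positive, which is all nested⇒big needs.
positive : ∀ {f} → BoundingFunction f → ∀ n → 1 ≤ f n
positive bounding n = ≤-trans (s≤s z≤n) (bounding n)

lemma3p8 : (g g' h h' : ℕ → ℕ)
    → BoundingFunction g → BoundingFunction g'
    → BoundingFunction h → BoundingFunction h'
    → (σ μ : Str) → (B C : PairSet)
    → Big (g ⊕ g') (h ⊕ h') (λ p → B p ⊎ C p) σ μ
    → Big g h B σ μ ⊎ Big g' h' C σ μ
lemma3p8 g g' h h' bg bg' bh bh' σ μ B C big =
  Sum.map (nested⇒big (positive bg) (positive bh)) (nested⇒big (positive bg') (positive bh'))
    (split (mapBushyTree (λ τ → split) (big⇒nested big)))
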